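{- Let $(\mathcal{A}_n(x))_{n\ge 0}$ be a sequence of Appell polynomials defined by $\sum_{n\ge0}\mathcal{A}_n(x)\frac{t^n}{n!}=F(t)e^{xt}$ with $F(0)=1$, where $\mathcal{A}_n:=\mathcal{A}_n(0)$ is a nonnegative integer for every $n$, so that $\mathcal{A}_n(x)=\sum_{k=0}^n\binom{n}{k}\mathcal{A}_{n-k}x^k\in\mathbb{Z}[x]$. Let $p$ be an odd prime and suppose there is an integer $t$ such that $\mathcal{A}_{n+p}\equiv t\,\mathcal{A}_n \pmod p$ for every integer $n\ge 0$. Let $s\ge1$ and $m_0,m_1,\dots,m_s\ge 0$ be integers. Then for every polynomial $f(y)=\sum_k c_k y^k\in\mathbb{Z}[y]$, $$\sum_k c_k\,\mathcal{A}_{k+m_1p+\cdots+m_sp^s}(x)\equiv \left(x^{p}+t\right)^{m_1}\cdots\left(x^{p^s}+t\right)^{m_s}\sum_k c_k\,\mathcal{A}_k(x)\pmod p.$$ Equivalently (taking $f(y)=y^{m_0}$), $$\mathcal{A}_{m_0+m_1p+\cdots+m_sp^s}(x)\equiv \left(x^{p}+t\right)^{m_1}\cdots\left(x^{p^s}+t\right)^{m_s}\mathcal{A}_{m_0}(x)\pmod p,$$ and in particular $\mathcal{A}_{m_1p+\cdots+m_sp^s}(x)\equiv \left(x^{p}+t\right)^{m_1}\cdots\left(x^{p^s}+t\right)^{m_s}\pmod p$.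
   Context: A congruence $P(x)\equiv Q(x)\pmod p$ between polynomials with integer coefficients means that every coefficient of $P(x)-Q(x)$ is divisible by $p$. -}

module Defs where

open import Data.Nat as ℕ using (ℕ; zero; suc)
open import Data.Nat.Combinatorics using (_C_)
open import Data.Integer as ℤ using (ℤ; +_)
open import Data.Integer.Divisibility using (_∣_)
open import Data.List using (List; []; _∷_; map; replicate; upTo; foldr)
open import Data.Vec using (Vec; []; _∷_)

-- Polynomials with integer coefficients, as coefficient lists
-- (lowest degree first): [a₀, a₁, …, a_d] represents a₀ + a₁ x + ⋯ + a_d x^d.
Poly : Set
Poly = List ℤ

coeff : Poly → ℕ → ℤ
coeff []       _       = + 0
coeff (a ∷ _)  zero    = a
coeff (_ ∷ as) (suc k) = coeff as k

infixl 6 _+P_ _-P_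
infixl 7 _*P_ _·P_

_+P_ : Poly → Poly → Poly
[]       +P q        = q
(a ∷ as) +P []       = a ∷ as
(a ∷ as) +P (b ∷ bs) = (a ℤ.+ b) ∷ (as +P bs)

_·P_ : ℤ → Poly → Poly
c ·P q = map (c ℤ.*_) q

_-P_ : Poly → Poly → Poly
q -P r = q +P ((ℤ.- + 1) ·P r)

_*P_ : Poly → Poly → Poly
[]       *P q = []
(a ∷ as) *P q = (a ·P q) +P (+ 0 ∷ (as *P q))

constP : ℤ → Poly
constP c = c ∷ []

oneP : Poly
oneP = constP (+ 1)

X^ : ℕ → Poly
X^ k = replicate k (+ 0) ++' (+ 1 ∷ [])
  where
  _++'_ : List ℤ → List ℤ → List ℤ
  []       ++' ys = ys
  (x ∷ xs) ++' ys = x ∷ (xs ++' ys)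

_^P_ : Poly → ℕ → Poly
q ^P zero  = oneP
q ^P suc n = q *P (q ^P n)

_≡P_[mod_] : Poly → Poly → ℕ → Set
P ≡P Q [mod p ] = ∀ k → (+ p) ∣ coeff (P -P Q) k

appell : (ℕ → ℕ) → ℕ → Poly
appell A n = map (λ k → + ((n C k) ℕ.* A (n ℕ.∸ k))) (upTo (suc n))

-- Σ_k c_k 𝒜_{k+N}(x)  for f(y) = Σ_k c_k y^k given by the coefficient list c
appellSum : (ℕ → ℕ) → Poly → ℕ → Poly
appellSum A c N = go 0 c
  where
  go : ℕ → Poly → Poly
  go k []       = []
  go k (ck ∷ cs) = (ck ·P appell A (k ℕ.+ N)) +P go (suc k) cs

digitSum : (p : ℕ) → {s : ℕ} → Vec ℕ s → ℕ
digitSum p ms = go 1 ms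
  where
  go : ℕ → {s : ℕ} → Vec ℕ s → ℕ
  go j []       = 0
  go j (m ∷ ms) = m ℕ.* (p ℕ.^ j) ℕ.+ go (suc j) ms

factorProd : (p : ℕ) → ℤ → {s : ℕ} → Vec ℕ s → Poly
factorProd p t ms = go 1 ms
  where
  go : ℕ → {s : ℕ} → Vec ℕ s → Poly
  go j []       = oneP
  go j (m ∷ ms) = ((X^ (p ℕ.^ j) +P constP t) ^P m) *P go (suc j) ms

{-# OPTIONS --safe #-}

-- Let q = p^j with j ≥ 1. Then p divides C(q,k)
-- for 0 < k < q, so Pascal's rule gives C(n+q,k) ≡ C(n,k) + C(n,k-q) (mod p) by induction on n.
-- Iterating A_{m+p} ≡ t A_m gives A_{m+q} ≡ t^{p^(j-1)} A_m ≡ t A_m by Fermat's little theorem, which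
-- follows from the Frobenius identity (x + y)^p = x^p + y^p in ℤ/pℤ. Together,
-- 𝒜_{n+q}(x) ≡ (x^q + t) 𝒜_n(x) (mod p); composing these shifts along m₁p + ⋯ + m_s p^s and using
-- linearity in f proves the theorem.

module Submission where

open import Defs
open import Data.Nat.Base using (ℕ; zero; suc)
open import Data.Nat.Primality using (Prime)
open import Data.Integer.Base using (ℤ)
open import Data.Vec.Base using (Vec)
open import Relation.Binary.PropositionalEquality as ≡ using (_≡_; _≗_)
open import Algebra.Bundles using (CommutativeSemiring; CommutativeRing)

module BinomialDivisibility where
  open import Data.Nat.Base
  open import Data.Nat.Properties
  open import Data.Nat.Combinatorics using (_C_; nC1≡n; nCk+nC[k+1]≡[n+1]C[k+1])
  open import Data.Nat.Divisibility
  open import Data.Nat.Primality using (Prime; euclidsLemma; prime⇒nonZero)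
  open import Data.Sum using (inj₁; inj₂)
  open import Relation.Nullary using (¬_; contradiction)
  open ≡
  open ≡-Reasoning

  [1+k]*[1+n]C[1+k]≡[1+n]*nCk : ∀ n k → suc k * (suc n C suc k) ≡ suc n * (n C k)
  [1+k]*[1+n]C[1+k]≡[1+n]*nCk zero    zero    = refl
  [1+k]*[1+n]C[1+k]≡[1+n]*nCk zero    (suc k) = *-zeroʳ (suc (suc k))
  [1+k]*[1+n]C[1+k]≡[1+n]*nCk (suc n) zero    =
    trans (*-identityˡ _) (trans (nC1≡n (suc (suc n))) (sym (*-identityʳ _)))
  [1+k]*[1+n]C[1+k]≡[1+n]*nCk (suc n) (suc k) = begin
    suc (suc k) * (suc (suc n) C suc (suc k))
      ≡⟨ cong (suc (suc k) *_) (nCk+nC[k+1]≡[n+1]C[k+1] (suc n) (suc k)) ⟨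
    suc (suc k) * (suc n C suc k + suc n C suc (suc k))
      ≡⟨ *-distribˡ-+ (suc (suc k)) (suc n C suc k) _ ⟩
    suc n C suc k + suc k * (suc n C suc k) + suc (suc k) * (suc n C suc (suc k))
      ≡⟨ cong₂ (λ a b → suc n C suc k + a + b)
           ([1+k]*[1+n]C[1+k]≡[1+n]*nCk n k) ([1+k]*[1+n]C[1+k]≡[1+n]*nCk n (suc k)) ⟩
    suc n C suc k + suc n * (n C k) + suc n * (n C suc k)
      ≡⟨ +-assoc (suc n C suc k) _ _ ⟩
    suc n C suc k + (suc n * (n C k) + suc n * (n C suc k))
      ≡⟨ cong (suc n C suc k +_) (*-distribˡ-+ (suc n) (n C k) (n C suc k)) ⟨
    suc n C suc k + suc n * (n C k + n C suc k)
      ≡⟨ cong (λ c → suc n C suc k + suc n * c) (nCk+nC[k+1]≡[n+1]C[k+1] n k) ⟩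
    suc (suc n) * (suc n C suc k) ∎

  module _ {p} (p-prime : Prime p) where
    instance
      _ : NonZero p
      _ = prime⇒nonZero p-prime

    p^[1+j]∣m*n∧p^[1+j]∤m⇒p∣n : ∀ j {m n} → p ^ suc j ∣ m * n → ¬ p ^ suc j ∣ m → p ∣ n
    p^[1+j]∣m*n∧p^[1+j]∤m⇒p∣n j {m} {n} pʲ∣mn pʲ∤m
      with euclidsLemma m n p-prime (∣-trans (m∣m*n (p ^ j)) pʲ∣mn)
    ... | inj₂ p∣n = p∣n
    p^[1+j]∣m*n∧p^[1+j]∤m⇒p∣n zero    pʲ∣mn pʲ∤m | inj₁ p∣m =
      contradiction (subst (_∣ _) (sym (*-identityʳ p)) p∣m) pʲ∤m
    p^[1+j]∣m*n∧p^[1+j]∤m⇒p∣n (suc j) {n = n} pʲ∣mn pʲ∤m | inj₁ (divides d refl) =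
      p^[1+j]∣m*n∧p^[1+j]∤m⇒p∣n j
        (*-cancelˡ-∣ p (subst (p ^ suc (suc j) ∣_) (d*p*n≡p*[d*n]) pʲ∣mn))
        (λ pʲ∣d → pʲ∤m (subst (p ^ suc (suc j) ∣_) (*-comm p d) (*-monoʳ-∣ p pʲ∣d)))
      where
      d*p*n≡p*[d*n] : d * p * n ≡ p * (d * n)
      d*p*n≡p*[d*n] = trans (cong (_* n) (*-comm d p)) (*-assoc p d n)

    p∣[p^j]Ck : ∀ j {k} → 0 < k → k < p ^ j → p ∣ (p ^ j) C k
    p∣[p^j]Ck zero    {suc k} _ (s≤s ())
    p∣[p^j]Ck (suc j) {suc k} _ k<pʲ with p ^ suc j in pʲ≡
    ... | suc n = p^[1+j]∣m*n∧p^[1+j]∤m⇒p∣n j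
      (subst (_∣ suc k * (suc n C suc k)) (sym pʲ≡)
        (divides (n C k) (trans ([1+k]*[1+n]C[1+k]≡[1+n]*nCk n k) (*-comm (suc n) (n C k)))))
      (λ pʲ∣k → <⇒≱ k<pʲ (subst (_≤ suc k) pʲ≡ (∣⇒≤ pʲ∣k)))

    p∣pCk : ∀ {k} → 0 < k → k < p → p ∣ p C k
    p∣pCk {k} 0<k k<p = subst (λ q → p ∣ q C k) (*-identityʳ p)
      (p∣[p^j]Ck 1 0<k (subst (k <_) (sym (*-identityʳ p)) k<p))

module Frobenius {a ℓ} (S : CommutativeSemiring a ℓ) where
  open import Data.Nat.Base as ℕ using (suc)
  open import Data.Nat.Combinatorics using (nCn≡1)
  open import Data.Nat.Divisibility using (_∣_; divides)
  import Data.Nat.Properties as ℕ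
  open import Data.Fin.Base as Fin using (suc; inject₁; fromℕ)
  open import Data.Fin.Properties using (toℕ-inject₁; toℕ-fromℕ; toℕ<n)
  open import Data.Vec.Functional using (replicate)
  open CommutativeSemiring S hiding (zero)
  open import Algebra.Properties.CommutativeSemiring.Binomial S using (theorem; binomialTerm)
  open import Algebra.Properties.Semiring.Exp semiring using (_^_)
  open import Algebra.Properties.Semiring.Mult semiring using (_×_; ×-congʳ; ×-congˡ; ×-assocˡ; ×-assoc-*)
  open import Algebra.Properties.Semiring.Sum semiring using (sum; sum-cong-≋; sum-init-last; sum-replicate-zero)
  open import Relation.Binary.Reasoning.Setoid setoid
  open BinomialDivisibility using (p∣pCk)

  n×x≈[n×1]*x : ∀ n x → n × x ≈ (n × 1#) * x
  n×x≈[n×1]*x n x = trans (×-congʳ n (sym (*-identityˡ x))) (sym (×-assoc-* n 1# x))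

  p∣n⇒n×x≈0 : ∀ {p n} → p × 1# ≈ 0# → p ∣ n → ∀ x → n × x ≈ 0#
  p∣n⇒n×x≈0 {p} char-p (divides d ≡.refl) x = begin
    (d ℕ.* p) × x      ≈⟨ ×-congˡ (ℕ.*-comm d p) ⟩
    (p ℕ.* d) × x      ≈⟨ ×-assocˡ x p d ⟨
    p × (d × x)        ≈⟨ n×x≈[n×1]*x p (d × x) ⟩
    (p × 1#) * (d × x) ≈⟨ *-congʳ char-p ⟩
    0# * (d × x)       ≈⟨ zeroˡ _ ⟩
    0#                 ∎

  frobenius : ∀ {p} → Prime p → p × 1# ≈ 0# → ∀ x y → (x + y) ^ p ≈ x ^ p + y ^ p
  frobenius {suc m} p-prime char-p x y = begin
    (x + y) ^ suc m                     ≈⟨ theorem (suc m) x y ⟩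
    term Fin.zero + sum (λ i → term (suc i)) ≈⟨ +-congˡ (sum-init-last (λ i → term (suc i))) ⟩
    term Fin.zero + (sum (λ i → term (suc (inject₁ i))) + term (suc (fromℕ m)))
      ≈⟨ +-cong (+-identityʳ _) (+-cong (sum-cong-≋ middle-vanishes) last-term) ⟩
    1# * y ^ suc m + (sum (replicate m 0#) + x ^ suc m)
      ≈⟨ +-cong (*-identityˡ _) (+-congʳ (sum-replicate-zero m)) ⟩
    y ^ suc m + (0# + x ^ suc m)        ≈⟨ +-congˡ (+-identityˡ _) ⟩
    y ^ suc m + x ^ suc m               ≈⟨ +-comm _ _ ⟩
    x ^ suc m + y ^ suc m               ∎
    where
    term : Fin.Fin (suc (suc m)) → Carrier
    term = binomialTerm x y (suc m)
    middle-vanishes : ∀ i → term (suc (inject₁ i)) ≈ 0#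
    middle-vanishes i = p∣n⇒n×x≈0 char-p
      (p∣pCk p-prime (ℕ.s≤s ℕ.z≤n) (ℕ.s≤s (≡.subst (ℕ._< m) (≡.sym (toℕ-inject₁ i)) (toℕ<n i))))
      _
    last-term : term (suc (fromℕ m)) ≈ x ^ suc m
    last-term rewrite toℕ-fromℕ m | nCn≡1 (suc m) | ℕ.n∸n≡0 m = trans (+-identityʳ _) (*-identityʳ _)

module IntegersModulo (n : ℕ) where
  open import Data.Integer.Base
  import Data.Integer.Properties as ℤ
  open import Data.Integer.Divisibility.Signed
    using (_∣_; divides; ∣ᵤ⇒∣; ∣m∣n⇒∣m+n; ∣m⇒∣-m; ∣m⇒∣m*n; ∣n⇒∣m*n)
  import Data.Nat.Divisibility as ℕ
  import Data.Integer.Divisibility as Unsigned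
  open import Data.Integer.Tactic.RingSolver using (solve-∀)
  open import Algebra.Structures using (IsCommutativeRing)
  open import Relation.Binary.Structures using (IsEquivalence)
  open import Data.Product using (_,_)
  open import Level using (0ℓ)

  -- A record rather than a synonym, so that a and b can be inferred from a proof of a ≈ b.
  infix 4 _≈_
  record _≈_ (a b : ℤ) : Set where
    constructor congruent
    field modulus∣difference : + n ∣ a - b
  open _≈_ public

  private
    b-a≡-[a-b] : ∀ a b → b - a ≡ - (a - b)
    b-a≡-[a-b] = solve-∀
    a-c≡[a-b]+[b-c] : ∀ a b c → a - c ≡ (a - b) + (b - c)
    a-c≡[a-b]+[b-c] = solve-∀
    [a+c]-[b+d]≡[a-b]+[c-d] : ∀ a b c d → (a + c) - (b + d) ≡ (a - b) + (c - d)
    [a+c]-[b+d]≡[a-b]+[c-d] = solve-∀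
    ac-bd≡[a-b]c+b[c-d] : ∀ a b c d → a * c - b * d ≡ (a - b) * c + b * (c - d)
    ac-bd≡[a-b]c+b[c-d] = solve-∀
    -a--b≡-[a-b] : ∀ a b → - a - - b ≡ - (a - b)
    -a--b≡-[a-b] = solve-∀

    ≈-resp : ∀ {a b d} → a - b ≡ d → + n ∣ d → a ≈ b
    ≈-resp a-b≡d n∣d = congruent (≡.subst (+ n ∣_) (≡.sym a-b≡d) n∣d)

  ≡⇒≈ : ∀ {a b} → a ≡ b → a ≈ b
  ≡⇒≈ {a} ≡.refl = ≈-resp (ℤ.+-inverseʳ a) (divides 0ℤ ≡.refl)

  ≈-isEquivalence : IsEquivalence _≈_
  ≈-isEquivalence = record
    { refl  = ≡⇒≈ ≡.refl
    ; sym   = λ {a} {b} a≈b → ≈-resp (b-a≡-[a-b] a b) (∣m⇒∣-m (modulus∣difference a≈b))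
    ; trans = λ {a} {b} {c} a≈b b≈c → ≈-resp (a-c≡[a-b]+[b-c] a b c)
                (∣m∣n⇒∣m+n (modulus∣difference a≈b) (modulus∣difference b≈c))
    }

  +-cong : ∀ {a b c d} → a ≈ b → c ≈ d → a + c ≈ b + d
  +-cong {a} {b} {c} {d} a≈b c≈d = ≈-resp ([a+c]-[b+d]≡[a-b]+[c-d] a b c d)
    (∣m∣n⇒∣m+n (modulus∣difference a≈b) (modulus∣difference c≈d))

  *-cong : ∀ {a b c d} → a ≈ b → c ≈ d → a * c ≈ b * d
  *-cong {a} {b} {c} {d} a≈b c≈d =
    ≈-resp (ac-bd≡[a-b]c+b[c-d] a b c d)
      (∣m∣n⇒∣m+n (∣m⇒∣m*n c (modulus∣difference a≈b)) (∣n⇒∣m*n b (modulus∣difference c≈d)))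

  -‿cong : ∀ {a b} → a ≈ b → - a ≈ - b
  -‿cong {a} {b} a≈b = ≈-resp (-a--b≡-[a-b] a b) (∣m⇒∣-m (modulus∣difference a≈b))

  isCommutativeRing : IsCommutativeRing _≈_ _+_ _*_ -_ 0ℤ 1ℤ
  isCommutativeRing = record
    { isRing = record
      { +-isAbelianGroup = record
        { isGroup = record
          { isMonoid = record
            { isSemigroup = record
              { isMagma = record { isEquivalence = ≈-isEquivalence ; ∙-cong = +-cong }
              ; assoc = λ a b c → ≡⇒≈ (ℤ.+-assoc a b c)
              }
            ; identity = (λ a → ≡⇒≈ (ℤ.+-identityˡ a)) , (λ a → ≡⇒≈ (ℤ.+-identityʳ a))
            }
          ; inverse = (λ a → ≡⇒≈ (ℤ.+-inverseˡ a)) , (λ a → ≡⇒≈ (ℤ.+-inverseʳ a))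
          ; ⁻¹-cong = -‿cong
          }
        ; comm = λ a b → ≡⇒≈ (ℤ.+-comm a b)
        }
      ; *-cong = *-cong
      ; *-assoc = λ a b c → ≡⇒≈ (ℤ.*-assoc a b c)
      ; *-identity = (λ a → ≡⇒≈ (ℤ.*-identityˡ a)) , (λ a → ≡⇒≈ (ℤ.*-identityʳ a))
      ; distrib = (λ a b c → ≡⇒≈ (ℤ.*-distribˡ-+ a b c)) , (λ a b c → ≡⇒≈ (ℤ.*-distribʳ-+ a b c))
      }
    ; *-comm = λ a b → ≡⇒≈ (ℤ.*-comm a b)
    }

  commutativeRing : CommutativeRing 0ℓ 0ℓ
  commutativeRing = record { isCommutativeRing = isCommutativeRing }

  ∣ᵤ⇒≈ : ∀ {a b} → + n Unsigned.∣ a - b → a ≈ b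
  ∣ᵤ⇒≈ n∣a-b = congruent (∣ᵤ⇒∣ n∣a-b)

  ∣⇒≈0 : ∀ {m} → n ℕ.∣ m → + m ≈ 0ℤ
  ∣⇒≈0 {m} n∣m = ≈-resp (ℤ.+-identityʳ (+ m)) (∣ᵤ⇒∣ n∣m)

module Fermat {p} (p-prime : Prime p) where
  open import Data.Nat.Base as ℕ using (NonZero)
  open import Data.Nat.Primality using (prime⇒nonZero)
  open import Data.Integer.Base using (+_; -[1+_]; 0ℤ; 1ℤ)
  open IntegersModulo p using (commutativeRing; ≡⇒≈; ∣⇒≈0)
  open import Data.Nat.Divisibility using (∣-refl)
  open CommutativeRing commutativeRing hiding (zero)
  open import Algebra.Properties.Semiring.Exp semiring using (_^_; ^-congˡ; ^-assocʳ)
  open import Algebra.Properties.Semiring.Mult semiring using (_×_)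
  open import Algebra.Properties.Monoid.Mult *-monoid using () renaming (×-idem to ^-idem)
  open import Algebra.Properties.Group +-group using (inverseʳ-unique)
  open import Relation.Binary.Reasoning.Setoid setoid
  open Frobenius commutativeSemiring using (frobenius)

  instance
    _ : NonZero p
    _ = prime⇒nonZero p-prime

  n×1≡+n : ∀ n → n × 1ℤ ≡ + n
  n×1≡+n zero    = ≡.refl
  n×1≡+n (suc n) = ≡.cong (_+_ 1ℤ) (n×1≡+n n)

  p×1≈0 : p × 1ℤ ≈ 0ℤ
  p×1≈0 = trans (≡⇒≈ (n×1≡+n p)) (∣⇒≈0 ∣-refl)

  [+n]^p≈+n : ∀ n → (+ n) ^ p ≈ + n
  [+n]^p≈+n zero    = ^-idem (zeroˡ 0ℤ) p
  [+n]^p≈+n (suc n) = begin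
    (1ℤ + + n) ^ p     ≈⟨ frobenius p-prime p×1≈0 1ℤ (+ n) ⟩
    1ℤ ^ p + (+ n) ^ p ≈⟨ +-cong (^-idem (*-identityˡ 1ℤ) p) ([+n]^p≈+n n) ⟩
    1ℤ + + n           ∎

  x^p≈x : ∀ x → x ^ p ≈ x
  x^p≈x (+ n)    = [+n]^p≈+n n
  x^p≈x -[1+ n ] = begin
    (- x) ^ p      ≈⟨ inverseʳ-unique (x ^ p) ((- x) ^ p) x^p+[-x]^p≈0 ⟩
    - (x ^ p)      ≈⟨ -‿cong ([+n]^p≈+n (suc n)) ⟩
    - x            ∎
    where
    x : ℤ
    x = + suc n
    x^p+[-x]^p≈0 : x ^ p + (- x) ^ p ≈ 0ℤ
    x^p+[-x]^p≈0 = begin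
      x ^ p + (- x) ^ p ≈⟨ frobenius p-prime p×1≈0 x (- x) ⟨
      (x - x) ^ p       ≈⟨ ^-congˡ p (-‿inverseʳ x) ⟩
      0ℤ ^ p            ≈⟨ ^-idem (zeroˡ 0ℤ) p ⟩
      0ℤ                ∎

  x^[p^j]≈x : ∀ j x → x ^ (p ℕ.^ j) ≈ x
  x^[p^j]≈x zero    x = *-identityʳ x
  x^[p^j]≈x (suc j) x = begin
    x ^ (p ℕ.* p ℕ.^ j) ≈⟨ ^-assocʳ x p (p ℕ.^ j) ⟨
    (x ^ p) ^ p ℕ.^ j   ≈⟨ ^-congˡ (p ℕ.^ j) (x^p≈x x) ⟩
    x ^ p ℕ.^ j         ≈⟨ x^[p^j]≈x j x ⟩
    x                   ∎

module PolynomialAlgebra where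
  import Data.Nat.Base as ℕ
  open import Data.Integer.Base hiding (suc)
  import Data.Integer.Properties as ℤ
  open import Data.Integer.Tactic.RingSolver using (solve-∀)
  open import Data.List.Base using ([]; _∷_)
  open import Relation.Binary.Bundles using (Setoid)
  open ≡ using (refl; sym; trans; cong; cong₂)
  import Relation.Binary.Reasoning.Setoid as SetoidReasoning

  infix 4 _≃_
  record _≃_ (P Q : Poly) : Set where
    constructor coeffwise
    field coeff-≡ : coeff P ≗ coeff Q
  open _≃_ public

  ≃-setoid : Setoid _ _
  ≃-setoid = record
    { Carrier       = Poly
    ; _≈_           = _≃_
    ; isEquivalence = record
      { refl  = coeffwise λ _ → refl
      ; sym   = λ P≃Q → coeffwise λ k → sym (coeff-≡ P≃Q k)
      ; trans = λ P≃Q Q≃R → coeffwise λ k → trans (coeff-≡ P≃Q k) (coeff-≡ Q≃R k)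
      }
    }

  open Setoid ≃-setoid public using () renaming (refl to ≃-refl; sym to ≃-sym)

  module ≃-Reasoning = SetoidReasoning ≃-setoid

  ∷-cong : ∀ a {P Q} → P ≃ Q → (a ∷ P) ≃ (a ∷ Q)
  ∷-cong a P≃Q = coeffwise λ where
    zero    → refl
    (suc k) → coeff-≡ P≃Q k

  coeff-+P : ∀ P Q k → coeff (P +P Q) k ≡ coeff P k + coeff Q k
  coeff-+P []      Q       k       = sym (ℤ.+-identityˡ _)
  coeff-+P (a ∷ P) []      k       = sym (ℤ.+-identityʳ _)
  coeff-+P (a ∷ P) (b ∷ Q) zero    = refl
  coeff-+P (a ∷ P) (b ∷ Q) (suc k) = coeff-+P P Q k

  coeff-·P : ∀ c P k → coeff (c ·P P) k ≡ c * coeff P k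
  coeff-·P c []      k       = sym (ℤ.*-zeroʳ c)
  coeff-·P c (a ∷ P) zero    = refl
  coeff-·P c (a ∷ P) (suc k) = coeff-·P c P k

  coeff--P : ∀ P Q k → coeff (P -P Q) k ≡ coeff P k - coeff Q k
  coeff--P P Q k =
    trans (coeff-+P P _ k) (cong (_+_ (coeff P k)) (trans (coeff-·P -1ℤ Q k) (ℤ.-1*i≡-i _)))

  coeff-0∷-·P : ∀ c P k → coeff (0ℤ ∷ (c ·P P)) k ≡ c * coeff (0ℤ ∷ P) k
  coeff-0∷-·P c P zero    = sym (ℤ.*-zeroʳ c)
  coeff-0∷-·P c P (suc k) = coeff-·P c P k

  coeff-∷-*P : ∀ a P Q k → coeff ((a ∷ P) *P Q) k ≡ a * coeff Q k + coeff (0ℤ ∷ (P *P Q)) k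
  coeff-∷-*P a P Q k = trans (coeff-+P (a ·P Q) _ k) (cong (_+ _) (coeff-·P a Q k))

  +P-cong : ∀ {P P′ Q Q′} → P ≃ P′ → Q ≃ Q′ → P +P Q ≃ P′ +P Q′
  +P-cong {P} {P′} {Q} {Q′} P≃P′ Q≃Q′ = coeffwise λ k → begin
    coeff (P +P Q) k        ≡⟨ coeff-+P P Q k ⟩
    coeff P k + coeff Q k   ≡⟨ cong₂ _+_ (coeff-≡ P≃P′ k) (coeff-≡ Q≃Q′ k) ⟩
    coeff P′ k + coeff Q′ k ≡⟨ coeff-+P P′ Q′ k ⟨
    coeff (P′ +P Q′) k      ∎
    where open ≡.≡-Reasoning

  0∷-*P : ∀ P Q → (0ℤ ∷ P) *P Q ≃ 0ℤ ∷ (P *P Q)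
  0∷-*P P Q = coeffwise λ k → trans (coeff-∷-*P 0ℤ P Q k) (ℤ.+-identityˡ _)

  *P-zeroʳ : ∀ P → P *P [] ≃ []
  *P-zeroʳ []      = ≃-refl
  *P-zeroʳ (a ∷ P) = coeffwise λ where
    zero    → refl
    (suc k) → coeff-≡ (*P-zeroʳ P) k

  constP-*P : ∀ c Q → constP c *P Q ≃ c ·P Q
  constP-*P c Q = coeffwise λ k → begin
    coeff (constP c *P Q) k             ≡⟨ coeff-∷-*P c [] Q k ⟩
    c * coeff Q k + coeff (0ℤ ∷ []) k   ≡⟨ cong (_+_ (c * coeff Q k)) (coeff-[0] k) ⟩
    c * coeff Q k + 0ℤ                  ≡⟨ ℤ.+-identityʳ _ ⟩
    c * coeff Q k                       ≡⟨ coeff-·P c Q k ⟨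
    coeff (c ·P Q) k                    ∎
    where
    open ≡.≡-Reasoning
    coeff-[0] : ∀ k → coeff (0ℤ ∷ []) k ≡ 0ℤ
    coeff-[0] zero    = refl
    coeff-[0] (suc k) = refl

  *P-identityˡ : ∀ Q → oneP *P Q ≃ Q
  *P-identityˡ Q = coeffwise λ k →
    trans (coeff-≡ (constP-*P 1ℤ Q) k) (trans (coeff-·P 1ℤ Q k) (ℤ.*-identityˡ _))

  shift : ℕ → (ℕ → ℤ) → ℕ → ℤ
  shift zero    f k       = f k
  shift (suc q) f zero    = 0ℤ
  shift (suc q) f (suc k) = shift q f k

  shift-< : ∀ {q k} f → k ℕ.< q → shift q f k ≡ 0ℤ
  shift-< {suc q} {zero}  f _              = refl
  shift-< {suc q} {suc k} f (ℕ.s≤s k<q) = shift-< f k<q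

  shift-≥ : ∀ {q k} f → q ℕ.≤ k → shift q f k ≡ f (k ℕ.∸ q)
  shift-≥ {zero}          f _              = refl
  shift-≥ {suc q} {suc k} f (ℕ.s≤s q≤k) = shift-≥ f q≤k

  shift-*ʳ : ∀ q f g {h} → (∀ i → f i * g (q ℕ.+ i) ≡ h i) → ∀ k → shift q f k * g k ≡ shift q h k
  shift-*ʳ zero    f g fg≡h k       = fg≡h k
  shift-*ʳ (suc q) f g fg≡h zero    = ℤ.*-zeroˡ (g zero)
  shift-*ʳ (suc q) f g fg≡h (suc k) = shift-*ʳ q f (λ i → g (suc i)) fg≡h k

  coeff-X^-*P : ∀ q Q → coeff (X^ q *P Q) ≗ shift q (coeff Q)
  coeff-X^-*P zero    Q k       = coeff-≡ (*P-identityˡ Q) k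
  coeff-X^-*P (suc q) Q zero    = coeff-≡ (0∷-*P (X^ q) Q) zero
  coeff-X^-*P (suc q) Q (suc k) = trans (coeff-≡ (0∷-*P (X^ q) Q) (suc k)) (coeff-X^-*P q Q k)

  *P-distribʳ : ∀ P Q R → (P +P Q) *P R ≃ P *P R +P Q *P R
  *P-distribʳ []      Q       R = ≃-refl
  *P-distribʳ (a ∷ P) []      R =
    coeffwise λ k → sym (trans (coeff-+P ((a ∷ P) *P R) [] k) (ℤ.+-identityʳ _))
  *P-distribʳ (a ∷ P) (b ∷ Q) R = coeffwise λ k → let r = coeff R k in begin
    coeff (((a + b) ∷ (P +P Q)) *P R) k
      ≡⟨ coeff-∷-*P (a + b) (P +P Q) R k ⟩
    (a + b) * r + coeff (0ℤ ∷ ((P +P Q) *P R)) k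
      ≡⟨ cong (_+_ ((a + b) * r)) (coeff-≡ (∷-cong 0ℤ (*P-distribʳ P Q R)) k) ⟩
    (a + b) * r + coeff ((0ℤ ∷ (P *P R)) +P (0ℤ ∷ (Q *P R))) k
      ≡⟨ cong (_+_ ((a + b) * r)) (coeff-+P (0ℤ ∷ (P *P R)) (0ℤ ∷ (Q *P R)) k) ⟩
    (a + b) * r + (coeff (0ℤ ∷ (P *P R)) k + coeff (0ℤ ∷ (Q *P R)) k)
      ≡⟨ [a+b]r+[u+v]≡[ar+u]+[br+v] a b r _ _ ⟩
    (a * r + coeff (0ℤ ∷ (P *P R)) k) + (b * r + coeff (0ℤ ∷ (Q *P R)) k)
      ≡⟨ cong₂ _+_ (coeff-∷-*P a P R k) (coeff-∷-*P b Q R k) ⟨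
    coeff ((a ∷ P) *P R) k + coeff ((b ∷ Q) *P R) k
      ≡⟨ coeff-+P ((a ∷ P) *P R) ((b ∷ Q) *P R) k ⟨
    coeff ((a ∷ P) *P R +P (b ∷ Q) *P R) k ∎
    where
    open ≡.≡-Reasoning
    [a+b]r+[u+v]≡[ar+u]+[br+v] : ∀ a b r u v → (a + b) * r + (u + v) ≡ (a * r + u) + (b * r + v)
    [a+b]r+[u+v]≡[ar+u]+[br+v] = solve-∀

  ·P-*P-assoc : ∀ c P R → (c ·P P) *P R ≃ c ·P (P *P R)
  ·P-*P-assoc c []      R = ≃-refl
  ·P-*P-assoc c (a ∷ P) R = coeffwise λ k → let r = coeff R k in begin
    coeff (((c * a) ∷ (c ·P P)) *P R) k
      ≡⟨ coeff-∷-*P (c * a) (c ·P P) R k ⟩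
    c * a * r + coeff (0ℤ ∷ ((c ·P P) *P R)) k
      ≡⟨ cong (_+_ (c * a * r)) (coeff-≡ (∷-cong 0ℤ (·P-*P-assoc c P R)) k) ⟩
    c * a * r + coeff (0ℤ ∷ (c ·P (P *P R))) k
      ≡⟨ cong (_+_ (c * a * r)) (coeff-0∷-·P c (P *P R) k) ⟩
    c * a * r + c * coeff (0ℤ ∷ (P *P R)) k
      ≡⟨ cau+cv≡c[au+v] c a r _ ⟩
    c * (a * r + coeff (0ℤ ∷ (P *P R)) k)
      ≡⟨ cong (c *_) (coeff-∷-*P a P R k) ⟨
    c * coeff ((a ∷ P) *P R) k
      ≡⟨ coeff-·P c ((a ∷ P) *P R) k ⟨
    coeff (c ·P ((a ∷ P) *P R)) k ∎
    where
    open ≡.≡-Reasoning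
    cau+cv≡c[au+v] : ∀ c a u v → c * a * u + c * v ≡ c * (a * u + v)
    cau+cv≡c[au+v] = solve-∀

  *P-assoc : ∀ P Q R → (P *P Q) *P R ≃ P *P (Q *P R)
  *P-assoc []      Q R = ≃-refl
  *P-assoc (a ∷ P) Q R = begin
    (a ·P Q +P (0ℤ ∷ (P *P Q))) *P R        ≈⟨ *P-distribʳ (a ·P Q) _ R ⟩
    (a ·P Q) *P R +P (0ℤ ∷ (P *P Q)) *P R   ≈⟨ +P-cong (·P-*P-assoc a Q R) (0∷-*P (P *P Q) R) ⟩
    a ·P (Q *P R) +P (0ℤ ∷ ((P *P Q) *P R)) ≈⟨ +P-cong ≃-refl (∷-cong 0ℤ (*P-assoc P Q R)) ⟩
    a ·P (Q *P R) +P (0ℤ ∷ (P *P (Q *P R))) ∎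
    where open ≃-Reasoning

  *P-distribˡ : ∀ P Q R → P *P (Q +P R) ≃ P *P Q +P P *P R
  *P-distribˡ []      Q R = ≃-refl
  *P-distribˡ (a ∷ P) Q R = coeffwise λ k → begin
    coeff ((a ∷ P) *P (Q +P R)) k
      ≡⟨ coeff-∷-*P a P (Q +P R) k ⟩
    a * coeff (Q +P R) k + coeff (0ℤ ∷ (P *P (Q +P R))) k
      ≡⟨ cong₂ (λ u v → a * u + v) (coeff-+P Q R k)
           (trans (coeff-≡ (∷-cong 0ℤ (*P-distribˡ P Q R)) k)
                  (coeff-+P (0ℤ ∷ (P *P Q)) (0ℤ ∷ (P *P R)) k)) ⟩
    a * (coeff Q k + coeff R k) + (coeff (0ℤ ∷ (P *P Q)) k + coeff (0ℤ ∷ (P *P R)) k)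
      ≡⟨ a[q+r]+[u+v]≡[aq+u]+[ar+v] a _ _ _ _ ⟩
    (a * coeff Q k + coeff (0ℤ ∷ (P *P Q)) k) + (a * coeff R k + coeff (0ℤ ∷ (P *P R)) k)
      ≡⟨ cong₂ _+_ (coeff-∷-*P a P Q k) (coeff-∷-*P a P R k) ⟨
    coeff ((a ∷ P) *P Q) k + coeff ((a ∷ P) *P R) k
      ≡⟨ coeff-+P ((a ∷ P) *P Q) ((a ∷ P) *P R) k ⟨
    coeff ((a ∷ P) *P Q +P (a ∷ P) *P R) k ∎
    where
    open ≡.≡-Reasoning
    a[q+r]+[u+v]≡[aq+u]+[ar+v] : ∀ a q r u v → a * (q + r) + (u + v) ≡ (a * q + u) + (a * r + v)
    a[q+r]+[u+v]≡[aq+u]+[ar+v] = solve-∀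

  *P-·P : ∀ c P Q → P *P (c ·P Q) ≃ c ·P (P *P Q)
  *P-·P c []      Q = ≃-refl
  *P-·P c (a ∷ P) Q = coeffwise λ k → begin
    coeff ((a ∷ P) *P (c ·P Q)) k
      ≡⟨ coeff-∷-*P a P (c ·P Q) k ⟩
    a * coeff (c ·P Q) k + coeff (0ℤ ∷ (P *P (c ·P Q))) k
      ≡⟨ cong₂ (λ u v → a * u + v) (coeff-·P c Q k)
           (trans (coeff-≡ (∷-cong 0ℤ (*P-·P c P Q)) k) (coeff-0∷-·P c (P *P Q) k)) ⟩
    a * (c * coeff Q k) + c * coeff (0ℤ ∷ (P *P Q)) k
      ≡⟨ a[cq]+cu≡c[aq+u] a c _ _ ⟩
    c * (a * coeff Q k + coeff (0ℤ ∷ (P *P Q)) k)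
      ≡⟨ cong (c *_) (coeff-∷-*P a P Q k) ⟨
    c * coeff ((a ∷ P) *P Q) k
      ≡⟨ coeff-·P c ((a ∷ P) *P Q) k ⟨
    coeff (c ·P ((a ∷ P) *P Q)) k ∎
    where
    open ≡.≡-Reasoning
    a[cq]+cu≡c[aq+u] : ∀ a c q u → a * (c * q) + c * u ≡ c * (a * q + u)
    a[cq]+cu≡c[aq+u] = solve-∀

  coeff-[X^q+c]*P : ∀ q c Q k → coeff ((X^ q +P constP c) *P Q) k ≡ shift q (coeff Q) k + c * coeff Q k
  coeff-[X^q+c]*P q c Q k = begin
    coeff ((X^ q +P constP c) *P Q) k
      ≡⟨ coeff-≡ (*P-distribʳ (X^ q) (constP c) Q) k ⟩
    coeff (X^ q *P Q +P constP c *P Q) k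
      ≡⟨ coeff-+P (X^ q *P Q) (constP c *P Q) k ⟩
    coeff (X^ q *P Q) k + coeff (constP c *P Q) k
      ≡⟨ cong₂ _+_ (coeff-X^-*P q Q k) (coeff-≡ (constP-*P c Q) k) ⟩
    shift q (coeff Q) k + coeff (c ·P Q) k
      ≡⟨ cong (_+_ (shift q (coeff Q) k)) (coeff-·P c Q k) ⟩
    shift q (coeff Q) k + c * coeff Q k ∎
    where open ≡.≡-Reasoning

module PolynomialsModulo (n : ℕ) where
  open import Data.Integer.Base using (0ℤ)
  open import Data.Integer.Divisibility.Signed using (_∣_; ∣⇒∣ᵤ)
  open import Data.List.Base using ([]; _∷_)
  open import Relation.Binary.Bundles using (Setoid)
  import Relation.Binary.Reasoning.Setoid as SetoidReasoning
  open IntegersModulo n using (commutativeRing; modulus∣difference)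
  open CommutativeRing commutativeRing using (_≈_; _+_; _*_; +-cong; *-congˡ; reflexive; trans)
    renaming (refl to ≈-refl; sym to ≈-sym)
  open PolynomialAlgebra using (_≃_; coeff-≡; coeff-+P; coeff-·P; coeff--P)

  infix 4 _≈ᴾ_
  record _≈ᴾ_ (P Q : Poly) : Set where
    constructor coeffwise
    field coeff-≈ : ∀ k → coeff P k ≈ coeff Q k
  open _≈ᴾ_ public

  ≈ᴾ-setoid : Setoid _ _
  ≈ᴾ-setoid = record
    { Carrier       = Poly
    ; _≈_           = _≈ᴾ_
    ; isEquivalence = record
      { refl  = coeffwise λ _ → ≈-refl
      ; sym   = λ P≈Q → coeffwise λ k → ≈-sym (coeff-≈ P≈Q k)
      ; trans = λ P≈Q Q≈R → coeffwise λ k → trans (coeff-≈ P≈Q k) (coeff-≈ Q≈R k)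
      }
    }

  module ≈ᴾ-Reasoning = SetoidReasoning ≈ᴾ-setoid

  ≃⇒≈ᴾ : ∀ {P Q} → P ≃ Q → P ≈ᴾ Q
  ≃⇒≈ᴾ P≃Q = coeffwise λ k → reflexive (coeff-≡ P≃Q k)

  ≈ᴾ⇒≡P[mod] : ∀ {P Q} → P ≈ᴾ Q → P ≡P Q [mod n ]
  ≈ᴾ⇒≡P[mod] {P} {Q} P≈Q k =
    ∣⇒∣ᵤ (≡.subst (_ ∣_) (≡.sym (coeff--P P Q k)) (modulus∣difference (coeff-≈ P≈Q k)))

  +P-cong : ∀ {P P′ Q Q′} → P ≈ᴾ P′ → Q ≈ᴾ Q′ → P +P Q ≈ᴾ P′ +P Q′
  +P-cong {P} {P′} {Q} {Q′} P≈P′ Q≈Q′ = coeffwise λ k → begin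
    coeff (P +P Q) k        ≡⟨ coeff-+P P Q k ⟩
    coeff P k + coeff Q k   ≈⟨ +-cong (coeff-≈ P≈P′ k) (coeff-≈ Q≈Q′ k) ⟩
    coeff P′ k + coeff Q′ k ≡⟨ coeff-+P P′ Q′ k ⟨
    coeff (P′ +P Q′) k      ∎
    where open SetoidReasoning (CommutativeRing.setoid commutativeRing)

  ·P-congʳ : ∀ c {P Q} → P ≈ᴾ Q → c ·P P ≈ᴾ c ·P Q
  ·P-congʳ c {P} {Q} P≈Q = coeffwise λ k → begin
    coeff (c ·P P) k ≡⟨ coeff-·P c P k ⟩
    c * coeff P k    ≈⟨ *-congˡ {c} (coeff-≈ P≈Q k) ⟩
    c * coeff Q k    ≡⟨ coeff-·P c Q k ⟨
    coeff (c ·P Q) k ∎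
    where open SetoidReasoning (CommutativeRing.setoid commutativeRing)

  0∷-cong : ∀ {P Q} → P ≈ᴾ Q → (0ℤ ∷ P) ≈ᴾ (0ℤ ∷ Q)
  0∷-cong P≈Q = coeffwise λ where
    zero    → ≈-refl
    (suc k) → coeff-≈ P≈Q k

  *P-congˡ : ∀ P {Q Q′} → Q ≈ᴾ Q′ → P *P Q ≈ᴾ P *P Q′
  *P-congˡ []      Q≈Q′ = coeffwise λ _ → ≈-refl
  *P-congˡ (a ∷ P) Q≈Q′ = +P-cong (·P-congʳ a Q≈Q′) (0∷-cong (*P-congˡ P Q≈Q′))

module ShiftedBinomials (p : ℕ) where
  open import Data.Nat.Base as ℕ using (NonZero; _<_; _∸_; s≤s; z≤n)
  import Data.Nat.Properties as ℕ
  open import Data.Nat.Combinatorics using (_C_; nCn≡1; nCk+nC[k+1]≡[n+1]C[k+1]; k>n⇒nCk≡0)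
  open import Data.Nat.Divisibility using (_∣_)
  open import Data.Integer.Base using (ℤ; +_)
  import Data.Integer.Properties as ℤ
  open import Relation.Binary.Definitions using (tri<; tri≈; tri>)
  open IntegersModulo p using (commutativeRing; ∣⇒≈0)
  open CommutativeRing commutativeRing hiding (zero)
  open import Relation.Binary.Reasoning.Setoid setoid
  open PolynomialAlgebra using (shift; shift-<; shift-≥)

  row : ℕ → ℕ → ℤ
  row n k = + (n C k)

  shift-row-Pascal : ∀ q n k → shift q (row (suc n)) k ≡ shift (suc q) (row n) k + shift q (row n) k
  shift-row-Pascal zero    n zero    = ≡.refl
  shift-row-Pascal zero    n (suc k) = ≡.cong +_ (≡.sym (nCk+nC[k+1]≡[n+1]C[k+1] n k))
  shift-row-Pascal (suc q) n zero    = ≡.refl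
  shift-row-Pascal (suc q) n (suc k) = shift-row-Pascal q n k

  row-q≈row-0+shift-row-0 : ∀ {q} .{{_ : NonZero q}} → (∀ {k} → 0 < k → k < q → p ∣ q C k) →
                      ∀ k → row q k ≈ row 0 k + shift q (row 0) k
  row-q≈row-0+shift-row-0 {suc q} p∣qCk zero    = refl
  row-q≈row-0+shift-row-0 {suc q} p∣qCk (suc k) = begin
    row (suc q) (suc k)                           ≈⟨ middle ⟩
    shift q (row 0) k                             ≡⟨ ℤ.+-identityˡ _ ⟨
    row 0 (suc k) + shift (suc q) (row 0) (suc k) ∎
    where
    middle : row (suc q) (suc k) ≈ shift q (row 0) k
    middle with ℕ.<-cmp k q
    ... | tri< k<q _ _ =
      trans (∣⇒≈0 (p∣qCk (s≤s z≤n) (s≤s k<q))) (reflexive (≡.sym (shift-< (row 0) k<q)))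
    ... | tri≈ _ ≡.refl _ = begin
      row (suc q) (suc q)  ≡⟨ ≡.cong +_ (nCn≡1 (suc q)) ⟩
      row 0 0              ≡⟨ ≡.cong (row 0) (ℕ.n∸n≡0 q) ⟨
      row 0 (q ∸ q)        ≡⟨ shift-≥ {q} (row 0) ℕ.≤-refl ⟨
      shift q (row 0) q    ∎
    ... | tri> _ _ q<k = begin
      row (suc q) (suc k)  ≡⟨ ≡.cong +_ (k>n⇒nCk≡0 (s≤s q<k)) ⟩
      + 0                  ≡⟨ ≡.cong +_ (k>n⇒nCk≡0 (ℕ.m<n⇒0<n∸m q<k)) ⟨
      row 0 (k ∸ q)        ≡⟨ shift-≥ {q} (row 0) (ℕ.<⇒≤ q<k) ⟨
      shift q (row 0) k    ∎

  row-+q≈row+shift-row : ∀ {q} .{{_ : NonZero q}} → (∀ {k} → 0 < k → k < q → p ∣ q C k) →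
                         ∀ n k → row (n ℕ.+ q) k ≈ row n k + shift q (row n) k
  row-+q≈row+shift-row p∣qCk zero    k       = row-q≈row-0+shift-row-0 p∣qCk k
  row-+q≈row+shift-row {q} p∣qCk (suc n) zero    = reflexive (≡.sym (≡.trans
    (≡.cong (_+_ (row (suc n) 0)) (shift-< (row (suc n)) (ℕ.>-nonZero⁻¹ q))) (ℤ.+-identityʳ _)))
  row-+q≈row+shift-row {q} p∣qCk (suc n) (suc k) = begin
    row (suc n ℕ.+ q) (suc k)
      ≡⟨ ≡.cong +_ (nCk+nC[k+1]≡[n+1]C[k+1] (n ℕ.+ q) k) ⟨
    row (n ℕ.+ q) k + row (n ℕ.+ q) (suc k)
      ≈⟨ +-cong (row-+q≈row+shift-row p∣qCk n k) (row-+q≈row+shift-row p∣qCk n (suc k)) ⟩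
    (row n k + shift q (row n) k) + (row n (suc k) + shift q (row n) (suc k))
      ≈⟨ interchange (row n k) (shift q (row n) k) (row n (suc k)) (shift q (row n) (suc k)) ⟩
    (row n k + row n (suc k)) + (shift q (row n) k + shift q (row n) (suc k))
      ≡⟨ ≡.cong₂ _+_ (≡.cong +_ (nCk+nC[k+1]≡[n+1]C[k+1] n k)) (≡.sym (shift-row-Pascal q n (suc k))) ⟩
    row (suc n) (suc k) + shift q (row (suc n)) (suc k) ∎
    where open import Algebra.Properties.CommutativeSemigroup +-commutativeSemigroup using (interchange)

module AppellCoefficients where
  open import Data.Nat.Base as ℕ using (_<_; _≤_; _∸_; s≤s)
  import Data.Nat.Properties as ℕ
  open import Data.Nat.Combinatorics using (_C_; k>n⇒nCk≡0)
  open import Data.Integer.Base using (ℤ; +_; 0ℤ; _*_)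
  import Data.Integer.Properties as ℤ
  open import Data.List.Base using (map; applyUpTo)
  open import Data.Sum using (inj₁; inj₂)

  coeff-map-applyUpTo-< : ∀ (f : ℕ → ℤ) g {m k} → k < m → coeff (map f (applyUpTo g m)) k ≡ f (g k)
  coeff-map-applyUpTo-< f g {suc m} {zero}  _           = ≡.refl
  coeff-map-applyUpTo-< f g {suc m} {suc k} (s≤s k<m) = coeff-map-applyUpTo-< f (λ i → g (suc i)) k<m

  coeff-map-applyUpTo-≥ : ∀ (f : ℕ → ℤ) g {m k} → m ≤ k → coeff (map f (applyUpTo g m)) k ≡ 0ℤ
  coeff-map-applyUpTo-≥ f g {zero}          _           = ≡.refl
  coeff-map-applyUpTo-≥ f g {suc m} {suc k} (s≤s m≤k) = coeff-map-applyUpTo-≥ f (λ i → g (suc i)) m≤k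

  coeff-appell : ∀ A n k → coeff (appell A n) k ≡ + (n C k) * + A (n ∸ k)
  coeff-appell A n k with ℕ.≤-<-connex k n
  ... | inj₁ k≤n = ≡.trans (coeff-map-applyUpTo-< _ (λ i → i) (s≤s k≤n)) (ℤ.pos-* (n C k) (A (n ∸ k)))
  ... | inj₂ n<k rewrite k>n⇒nCk≡0 n<k = coeff-map-applyUpTo-≥ _ (λ i → i) n<k

-- Defs computes digitSum, factorProd and appellSum with local helpers that carry a running index
-- (the exponent of p, resp. the index k of c_k). Abstracting that index with `with` makes each goal
-- below a unification pattern, which solves the metavariables to exactly these helpers; the
-- three *From functions are therefore the helpers with their index exposed.
mutual
  digitSumFrom : ℕ → ℕ → ∀ {s} → Vec ℕ s → ℕ
  digitSumFrom = _

  factorProdFrom : ℕ → ℤ → ℕ → ∀ {s} → Vec ℕ s → Poly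
  factorProdFrom = _

  appellSumFrom : (ℕ → ℕ) → ℕ → ℕ → Poly → Poly
  appellSumFrom = _

  digitSum≡digitSumFrom : ∀ p {s} (ms : Vec ℕ s) → digitSum p ms ≡ digitSumFrom p 1 ms
  digitSum≡digitSumFrom p ms with 1
  ... | j = ≡.refl

  factorProd≡factorProdFrom : ∀ p t {s} (ms : Vec ℕ s) → factorProd p t ms ≡ factorProdFrom p t 1 ms
  factorProd≡factorProdFrom p t ms with 1
  ... | j = ≡.refl

  appellSum≡appellSumFrom : ∀ A c N → appellSum A c N ≡ appellSumFrom A N 0 c
  appellSum≡appellSumFrom A c N with 0
  ... | k = ≡.refl

module AppellCongruences {p} (p-prime : Prime p) (A : ℕ → ℕ) (t : ℤ) where
  open import Data.Nat.Base as ℕ using (NonZero; _<_; _∸_)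
  import Data.Nat.Properties as ℕ
  open import Data.Nat.Combinatorics using (_C_; k>n⇒nCk≡0)
  open import Data.Nat.Divisibility using (_∣_)
  open import Data.Nat.Primality using (prime⇒nonZero)
  open import Data.Integer.Base using (+_)
  import Data.Integer.Properties as ℤ
  open import Data.List.Base using ([]; _∷_)
  import Data.Vec.Base as Vec
  open import Data.Sum using (inj₁; inj₂)
  open IntegersModulo p using (commutativeRing)
  open CommutativeRing commutativeRing hiding (zero)
  open import Algebra.Properties.Semiring.Exp semiring using (_^_)
  open import Algebra.Properties.CommutativeSemigroup *-commutativeSemigroup using (x∙yz≈y∙xz)
  open import Algebra.Properties.CommutativeSemigroup ℕ.+-commutativeSemigroup
    using () renaming (x∙yz≈xz∙y to x+[y+z]≡x+z+y)
  import Relation.Binary.Reasoning.Setoid as SetoidReasoning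
  module ≈-Reasoning = SetoidReasoning setoid
  open Fermat p-prime using (x^[p^j]≈x)
  open BinomialDivisibility using (p∣[p^j]Ck)
  open ShiftedBinomials p using (row; row-+q≈row+shift-row)
  open PolynomialAlgebra using (coeff-≡; ≃-sym; ≃-refl; shift; shift-*ʳ; coeff-[X^q+c]*P;
    *P-identityˡ; *P-zeroʳ; *P-assoc; *P-distribˡ; *P-·P) renaming (+P-cong to +P-cong≃)
  open PolynomialsModulo p
  open AppellCoefficients using (coeff-appell)

  instance
    _ : NonZero p
    _ = prime⇒nonZero p-prime

  step-iterate : ∀ (a : ℕ → ℤ) {q s} → (∀ m → a (m ℕ.+ q) ≈ s * a m) →
                 ∀ r m → a (m ℕ.+ r ℕ.* q) ≈ s ^ r * a m
  step-iterate a         step zero    m =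
    reflexive (≡.trans (≡.cong a (ℕ.+-identityʳ m)) (≡.sym (ℤ.*-identityˡ (a m))))
  step-iterate a {q} {s} step (suc r) m = begin
    a (m ℕ.+ (q ℕ.+ r ℕ.* q))  ≡⟨ ≡.cong a (x+[y+z]≡x+z+y m q (r ℕ.* q)) ⟩
    a (m ℕ.+ r ℕ.* q ℕ.+ q)    ≈⟨ step (m ℕ.+ r ℕ.* q) ⟩
    s * a (m ℕ.+ r ℕ.* q)      ≈⟨ *-congˡ {s} (step-iterate a step r m) ⟩
    s * (s ^ r * a m)          ≈⟨ *-assoc s (s ^ r) (a m) ⟨
    s * s ^ r * a m            ∎
    where open ≈-Reasoning

  record ShiftFactor (N : ℕ) (Q : Poly) : Set where
    constructor shiftFactor
    field appell-+ : ∀ n → appell A (n ℕ.+ N) ≈ᴾ Q *P appell A n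
  open ShiftFactor

  shiftFactor-0 : ShiftFactor 0 oneP
  shiftFactor-0 = shiftFactor λ n → begin
    appell A (n ℕ.+ 0)   ≡⟨ ≡.cong (appell A) (ℕ.+-identityʳ n) ⟩
    appell A n           ≈⟨ ≃⇒≈ᴾ (≃-sym (*P-identityˡ (appell A n))) ⟩
    oneP *P appell A n   ∎
    where open ≈ᴾ-Reasoning

  shiftFactor-+ : ∀ {M N P Q} → ShiftFactor M P → ShiftFactor N Q → ShiftFactor (M ℕ.+ N) (P *P Q)
  shiftFactor-+ {M} {N} {P} {Q} shift-M shift-N = shiftFactor λ n → begin
    appell A (n ℕ.+ (M ℕ.+ N))  ≡⟨ ≡.cong (appell A) (x+[y+z]≡x+z+y n M N) ⟩
    appell A (n ℕ.+ N ℕ.+ M)    ≈⟨ appell-+ shift-M (n ℕ.+ N) ⟩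
    P *P appell A (n ℕ.+ N)     ≈⟨ *P-congˡ P (appell-+ shift-N n) ⟩
    P *P (Q *P appell A n)      ≈⟨ ≃⇒≈ᴾ (≃-sym (*P-assoc P Q (appell A n))) ⟩
    (P *P Q) *P appell A n      ∎
    where open ≈ᴾ-Reasoning

  shiftFactor-* : ∀ {N Q} → ShiftFactor N Q → ∀ m → ShiftFactor (m ℕ.* N) (Q ^P m)
  shiftFactor-* shift-N zero    = shiftFactor-0
  shiftFactor-* shift-N (suc m) = shiftFactor-+ shift-N (shiftFactor-* shift-N m)

  shiftFactor-X^q+t : ∀ {q} .{{_ : NonZero q}} → (∀ {k} → 0 < k → k < q → p ∣ q C k) →
                      (∀ m → + A (m ℕ.+ q) ≈ t * + A m) → ShiftFactor q (X^ q +P constP t)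
  shiftFactor-X^q+t {q} p∣qCk step = shiftFactor λ n → coeffwise (coeff-appell-+q n)
    where
    open ≈-Reasoning

    -- Of C(n+q,k) ≡ C(n,k) + C(n,k-q), the first part picks up the factor t from A_{m+q} ≡ t A_m
    -- and the second is the coefficient of x^q 𝒜_n(x).
    coeff-appell-+q : ∀ n k → coeff (appell A (n ℕ.+ q)) k ≈ coeff ((X^ q +P constP t) *P appell A n) k
    coeff-appell-+q n k = begin
      coeff (appell A (n ℕ.+ q)) k
        ≡⟨ coeff-appell A (n ℕ.+ q) k ⟩
      row (n ℕ.+ q) k * a k
        ≈⟨ *-congʳ (row-+q≈row+shift-row p∣qCk n k) ⟩
      (row n k + shift q (row n) k) * a k
        ≈⟨ distribʳ (a k) (row n k) (shift q (row n) k) ⟩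
      row n k * a k + shift q (row n) k * a k
        ≈⟨ +-cong row-term (reflexive (shift-*ʳ q (row n) a shift-term k)) ⟩
      t * 𝒜ₙ k + shift q 𝒜ₙ k
        ≈⟨ +-comm (t * 𝒜ₙ k) (shift q 𝒜ₙ k) ⟩
      shift q 𝒜ₙ k + t * 𝒜ₙ k
        ≡⟨ coeff-[X^q+c]*P q t (appell A n) k ⟨
      coeff ((X^ q +P constP t) *P appell A n) k ∎
      where
      𝒜ₙ a : ℕ → ℤ
      𝒜ₙ = coeff (appell A n)
      a i = + A (n ℕ.+ q ∸ i)

      shift-term : ∀ i → row n i * a (q ℕ.+ i) ≡ 𝒜ₙ i
      shift-term i = ≡.trans
        (≡.cong (λ e → row n i * + A e)
          (≡.trans (≡.cong (_∸ (q ℕ.+ i)) (ℕ.+-comm n q)) (ℕ.[m+n]∸[m+o]≡n∸o q n i)))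
        (≡.sym (coeff-appell A n i))

      row-term : row n k * a k ≈ t * 𝒜ₙ k
      row-term with ℕ.≤-<-connex k n
      ... | inj₁ k≤n = begin
        row n k * a k                ≡⟨ ≡.cong (λ e → row n k * + A e) (ℕ.+-∸-comm q k≤n) ⟩
        row n k * + A (n ∸ k ℕ.+ q)  ≈⟨ *-congˡ {row n k} (step (n ∸ k)) ⟩
        row n k * (t * + A (n ∸ k))  ≈⟨ x∙yz≈y∙xz (row n k) t (+ A (n ∸ k)) ⟩
        t * (row n k * + A (n ∸ k))  ≡⟨ ≡.cong (t *_) (coeff-appell A n k) ⟨
        t * 𝒜ₙ k                     ∎
      ... | inj₂ n<k rewrite coeff-appell A n k | k>n⇒nCk≡0 n<k = reflexive (≡.sym (ℤ.*-zeroʳ t))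

  appellSumFrom-shift : ∀ {N Q} → ShiftFactor N Q →
                        ∀ k c → appellSumFrom A N k c ≈ᴾ Q *P appellSumFrom A 0 k c
  appellSumFrom-shift {N} {Q} shift-N k []       = ≃⇒≈ᴾ (≃-sym (*P-zeroʳ Q))
  appellSumFrom-shift {N} {Q} shift-N k (c ∷ cs) = begin
    c ·P appell A (k ℕ.+ N) +P S
      ≈⟨ +P-cong (·P-congʳ c (appell-+ shift-N k)) (appellSumFrom-shift shift-N (suc k) cs) ⟩
    c ·P (Q *P appell A k) +P Q *P S₀
      ≈⟨ ≃⇒≈ᴾ (+P-cong≃ (≃-sym (*P-·P c Q (appell A k))) ≃-refl) ⟩
    Q *P (c ·P appell A k) +P Q *P S₀
      ≈⟨ ≃⇒≈ᴾ (≃-sym (*P-distribˡ Q (c ·P appell A k) S₀)) ⟩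
    Q *P (c ·P appell A k +P S₀)
      ≡⟨ ≡.cong (λ i → Q *P (c ·P appell A i +P S₀)) (≡.sym (ℕ.+-identityʳ k)) ⟩
    Q *P (c ·P appell A (k ℕ.+ 0) +P S₀) ∎
    where
    open ≈ᴾ-Reasoning
    S S₀ : Poly
    S  = appellSumFrom A N (suc k) cs
    S₀ = appellSumFrom A 0 (suc k) cs

  module _ (step : ∀ n → + A (n ℕ.+ p) ≈ t * + A n) where

    step-p^[1+j] : ∀ j m → + A (m ℕ.+ p ℕ.^ suc j) ≈ t * + A m
    step-p^[1+j] j m = begin
      + A (m ℕ.+ p ℕ.* p ℕ.^ j)    ≡⟨ ≡.cong (λ e → + A (m ℕ.+ e)) (ℕ.*-comm p (p ℕ.^ j)) ⟩
      + A (m ℕ.+ p ℕ.^ j ℕ.* p)    ≈⟨ step-iterate (λ i → + A i) step (p ℕ.^ j) m ⟩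
      t ^ (p ℕ.^ j) * + A m        ≈⟨ *-congʳ (x^[p^j]≈x j t) ⟩
      t * + A m                    ∎
      where open ≈-Reasoning

    shiftFactor-p^[1+j] : ∀ j → ShiftFactor (p ℕ.^ suc j) (X^ (p ℕ.^ suc j) +P constP t)
    shiftFactor-p^[1+j] j =
      shiftFactor-X^q+t {{ℕ.m^n≢0 p (suc j)}} (p∣[p^j]Ck p-prime (suc j)) (step-p^[1+j] j)

    shiftFactor-digitSumFrom : ∀ j {s} (ms : Vec ℕ s) →
                               ShiftFactor (digitSumFrom p (suc j) ms) (factorProdFrom p t (suc j) ms)
    shiftFactor-digitSumFrom j Vec.[]       = shiftFactor-0
    shiftFactor-digitSumFrom j (m Vec.∷ ms) =
      shiftFactor-+ (shiftFactor-* (shiftFactor-p^[1+j] j) m) (shiftFactor-digitSumFrom (suc j) ms)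

open import Data.Nat.Base using (_+_)
open import Data.Integer.Base as ℤ using (+_)
open import Data.Integer.Divisibility using (_∣_)
open import Relation.Binary.PropositionalEquality using (_≢_)

corollary1 : (A : ℕ → ℕ) → A 0 ≡ 1 →
             (p : ℕ) → Prime p → p ≢ 2 →
             (t : ℤ) → (∀ n → (+ p) ∣ (+ A (n + p) ℤ.- t ℤ.* + A n)) →
             (s : ℕ) → (ms : Vec ℕ (suc s)) → (c : Poly) →
             appellSum A c (digitSum p ms) ≡P (factorProd p t ms *P appellSum A c 0) [mod p ]
corollary1 A _ p p-prime _ t hyp _ ms c = ≈ᴾ⇒≡P[mod] (begin
  appellSum A c (digitSum p ms)
    ≡⟨ ≡.cong (appellSum A c) (digitSum≡digitSumFrom p ms) ⟩
  appellSum A c (digitSumFrom p 1 ms)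
    ≡⟨ appellSum≡appellSumFrom A c (digitSumFrom p 1 ms) ⟩
  appellSumFrom A (digitSumFrom p 1 ms) 0 c
    ≈⟨ appellSumFrom-shift (shiftFactor-digitSumFrom step 0 ms) 0 c ⟩
  factorProdFrom p t 1 ms *P appellSumFrom A 0 0 c
    ≡⟨ ≡.cong₂ _*P_ (factorProd≡factorProdFrom p t ms) (appellSum≡appellSumFrom A c 0) ⟨
  factorProd p t ms *P appellSum A c 0 ∎)
  where
  open PolynomialsModulo p using (≈ᴾ⇒≡P[mod]; module ≈ᴾ-Reasoning)
  open ≈ᴾ-Reasoning
  open AppellCongruences p-prime A t using (appellSumFrom-shift; shiftFactor-digitSumFrom)
  step : ∀ n → IntegersModulo._≈_ p (+ A (n + p)) (t ℤ.* + A n)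
  step n = IntegersModulo.∣ᵤ⇒≈ p (hyp n)
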